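{- Let $p$ be an odd prime and $i\in\{1,2\}$. The relation $$R_i^p=\{(a,b)\in A_i^p\times A_i^p : a\in\langle b\rangle_i^p \text{ or } b\in\langle a\rangle_i^p\}$$ is an equivalence relation on $A_i^p$.
   Context: For an odd prime $p$ and $i\in\{1,2\}$, let $A_i^p=(\mathbb{Z}/p\mathbb{Z})^\times\setminus\{(-1)^i \bmod p\}$. For $g\in A_i^p$ define $u_1=g$ and $u_n=2u_{n-1}+(-1)^{i+1}$ in $\mathbb{Z}/p\mathbb{Z}$ for $n>1$; let $g_k^i=\min(\{n\in\mathbb{N}: u_n=0\}\cup\{\infty\})$, and call $\langle g\rangle_i^p=(u_n)_{1\le n<g_k^i}$ the rogue sequence of $g$. Here $a\in\langle b\rangle_i^p$ means $a$ is one of the terms of the rogue sequence $\langle b\rangle_i^p$. -}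

module Defs where

open import Data.Nat using (ℕ; zero; suc; _+_; _*_; _∸_; _<_; _≤_; NonZero)
open import Data.Nat.DivMod using (_%_)
open import Data.Fin using (Fin; toℕ; fromℕ<)
open import Data.Fin.Properties using ()
open import Data.Nat.DivMod using (m%n<n)
open import Data.Product using (Σ; ∃; _×_; _,_)
open import Data.Sum using (_⊎_)
open import Relation.Binary.PropositionalEquality using (_≡_; _≢_)
open import Relation.Nullary using (¬_)

-- Elements of Z/pZ are represented by their residues in Fin p
-- (canonical representatives 0,…,p-1).

data Idx : Set where
  i₁ i₂ : Idx

-- the residue of (-1)^i mod p  (i=1: p-1 ; i=2: 1)
signRes : Idx → ℕ → ℕ
signRes i₁ p = p ∸ 1
signRes i₂ p = 1

-- the additive constant (-1)^(i+1) mod p  (i=1: 1 ; i=2: p-1)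
addRes : Idx → ℕ → ℕ
addRes i₁ p = 1
addRes i₂ p = p ∸ 1

-- A_i^p : units of Z/pZ (nonzero residues, p prime) other than (-1)^i
InA : (i : Idx) (p : ℕ) → Fin p → Set
InA i p x = (toℕ x ≢ 0) × (toℕ x ≢ signRes i p)

A : (i : Idx) (p : ℕ) → Set
A i p = Σ (Fin p) (InA i p)

step : (i : Idx) (p : ℕ) .{{_ : NonZero p}} → Fin p → Fin p
step i p u = fromℕ< (m%n<n (2 * toℕ u + addRes i p) p)

-- u g n = u_n  (u_1 = g); we index so that  u g 1 = g
u : (i : Idx) (p : ℕ) .{{_ : NonZero p}} → Fin p → ℕ → Fin p
u i p g zero = g             -- junk value u_0 := g (never used)
u i p g (suc zero) = g
u i p g (suc (suc n)) = step i p (u i p g (suc n))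

-- InRogue i p a b  means  a ∈ ⟨b⟩_i^p : a = u_n for some n with 1 ≤ n < g_k^i, i.e. no u_m with
-- 1 ≤ m ≤ n is zero (g_k^i is the first index with u = 0, or ∞)
InRogue : (i : Idx) (p : ℕ) .{{_ : NonZero p}} → Fin p → Fin p → Set
InRogue i p a b =
  ∃ λ n → (1 ≤ n) × (∀ m → 1 ≤ m → m ≤ n → toℕ (u i p b m) ≢ 0) × (u i p b n ≡ a)

R : (i : Idx) (p : ℕ) .{{_ : NonZero p}} → A i p → A i p → Set
R i p (a , _) (b , _) = InRogue i p a b ⊎ InRogue i p b a

-- Since p is odd, 2 is invertible mod p, so the step u ↦ 2u ± 1 is injective. For an injective
-- map, two points whose forward orbits meet lie on a common orbit, one after the other, and the
-- terms of a rogue sequence are exactly the orbit points reached before the first zero. Hence of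
-- two points related to a third, one always occurs in the rogue sequence of the other.
module Submission where

open import Defs
open import Level using (Level)
open import Data.Nat using (ℕ; NonZero; zero; suc; _+_; _*_; _≤_; _<_; z≤n; s≤s)
open import Data.Nat.Properties
open import Data.Nat.DivMod using (_%_; _/_; m≡m%n+[m/n]*n)
open import Data.Nat.Divisibility using (_∣_; _∤_; divides; n∣m*n; ∣m+n∣m⇒∣n; >⇒∤)
open import Data.Nat.GeneralisedArithmetic using (iterate)
open import Data.Nat.Primality using (Prime; ¬prime[1]; euclidsLemma; irreducible[2])
open import Data.Nat.Tactic.RingSolver using (solve-∀)
open import Data.Fin using (toℕ)
open import Data.Fin.Properties using (toℕ-fromℕ<; toℕ-injective; toℕ<n)
open import Data.Product using (Σ; ∃; _×_; _,_; proj₁)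
open import Data.Sum using (_⊎_; inj₁; inj₂; [_,_]′; swap)
import Data.Sum as Sum
open import Data.Sum.Function.Propositional using (_⊎-⇔_)
open import Function using (_∘_; id; flip)
open import Function.Bundles using (_⇔_; mk⇔; Equivalence)
open import Function.Definitions using (Injective)
open import Relation.Nullary using (yes; no; contradiction)
open import Relation.Binary.PropositionalEquality
open import Relation.Binary.Structures using (IsEquivalence)

private
  variable
    a ℓ r : Level
    X : Set a

IsEquivalence-⇔ : {R Q : X → X → Set r} → (∀ {x y} → R x y ⇔ Q x y) →
                  IsEquivalence Q → IsEquivalence R
IsEquivalence-⇔ R⇔Q isEq = record
  { refl  = from R⇔Q Q.refl
  ; sym   = from R⇔Q ∘ Q.sym ∘ to R⇔Q
  ; trans = λ r s → from R⇔Q (Q.trans (to R⇔Q r) (to R⇔Q s))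
  }
  where
  module Q = IsEquivalence isEq
  open Equivalence

≤-total-+ : ∀ m n → (∃ λ o → m + o ≡ n) ⊎ (∃ λ o → n + o ≡ m)
≤-total-+ m n = Sum.map (λ le → m≤n⇒∃[o]m+o≡n le) (λ le → m≤n⇒∃[o]m+o≡n le) (≤-total m n)

[m+n]%d≡m%d⇒d∣n : ∀ m n d .{{_ : NonZero d}} → (m + n) % d ≡ m % d → d ∣ n
[m+n]%d≡m%d⇒d∣n m n d eq = ∣m+n∣m⇒∣n d∣[m/d]*d+n (n∣m*n (m / d))
  where
  open ≡-Reasoning
  d∣[m/d]*d+n : d ∣ m / d * d + n
  d∣[m/d]*d+n = divides ((m + n) / d) (+-cancelˡ-≡ (m % d) _ _ (begin
    m % d + (m / d * d + n)       ≡⟨ +-assoc (m % d) (m / d * d) n ⟨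
    m % d + m / d * d + n         ≡⟨ cong (_+ n) (m≡m%n+[m/n]*n m d) ⟨
    m + n                         ≡⟨ m≡m%n+[m/n]*n (m + n) d ⟩
    (m + n) % d + (m + n) / d * d ≡⟨ cong (_+ (m + n) / d * d) eq ⟩
    m % d + (m + n) / d * d       ∎))

∣∧<⇒≡0 : ∀ {d n} → d ∣ n → n < d → n ≡ 0
∣∧<⇒≡0 {n = zero}  _   _   = refl
∣∧<⇒≡0 {n = suc _} d∣n n<d = contradiction d∣n (>⇒∤ n<d)

prime≢2⇒∤2 : ∀ {p} → Prime p → p ≢ 2 → p ∤ 2
prime≢2⇒∤2 pp p≢2 p∣2 = [ (λ { refl → ¬prime[1] pp }) , p≢2 ]′ (irreducible[2] p∣2)

module _ {p} .{{_ : NonZero p}} (pp : Prime p) {k} (p∤k : p ∤ k) (c : ℕ) where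

  private
    affine-%-injective-≤ : ∀ {x y} → x ≤ y → y < p →
                           (k * x + c) % p ≡ (k * y + c) % p → x ≡ y
    affine-%-injective-≤ {x} x≤y y<p eq with m≤n⇒∃[o]m+o≡n x≤y
    ... | δ , refl = sym (trans (cong (x +_) δ≡0) (+-identityʳ x))
      where
      shift : ∀ k x δ c → k * (x + δ) + c ≡ (k * x + c) + k * δ
      shift = solve-∀
      p∣δ : p ∣ δ
      p∣δ = [ flip contradiction p∤k , id ]′ (euclidsLemma k δ pp
              ([m+n]%d≡m%d⇒d∣n (k * x + c) (k * δ) p
                (trans (cong (_% p) (sym (shift k x δ c))) (sym eq))))
      δ≡0 : δ ≡ 0
      δ≡0 = ∣∧<⇒≡0 p∣δ (≤-<-trans (m≤n+m δ x) y<p)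

  affine-%-injective : ∀ {x y} → x < p → y < p →
                       (k * x + c) % p ≡ (k * y + c) % p → x ≡ y
  affine-%-injective {x} {y} x<p y<p eq with ≤-total x y
  ... | inj₁ x≤y = affine-%-injective-≤ x≤y y<p eq
  ... | inj₂ y≤x = sym (affine-%-injective-≤ y≤x x<p (sym eq))

step-injective : ∀ {p} .{{_ : NonZero p}} → Prime p → p ≢ 2 → ∀ i →
                 Injective _≡_ _≡_ (step i p)
step-injective {p} pp p≢2 i {x} {y} eq = toℕ-injective
  (affine-%-injective pp (prime≢2⇒∤2 pp p≢2) (addRes i p) (toℕ<n x) (toℕ<n y)
    (trans (sym (toℕ-fromℕ< _)) (trans (cong toℕ eq) (toℕ-fromℕ< _))))

module _ (f : X → X) where

  iterate-suc : ∀ x n → iterate f x (suc n) ≡ f (iterate f x n)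
  iterate-suc x zero    = refl
  iterate-suc x (suc n) = iterate-suc (f x) n

  iterate-+ : ∀ x m n → iterate f x (m + n) ≡ iterate f (iterate f x m) n
  iterate-+ x zero    n = refl
  iterate-+ x (suc m) n = iterate-+ (f x) m n

  iterate-injective : Injective _≡_ _≡_ f → ∀ n {x y} → iterate f x n ≡ iterate f y n → x ≡ y
  iterate-injective inj zero    eq = eq
  iterate-injective inj (suc n) eq = inj (iterate-injective inj n eq)

module Orbit (f : X → X) (Good : X → Set ℓ) where

  GoodUpTo : X → ℕ → Set ℓ
  GoodUpTo x k = ∀ m → m ≤ k → Good (iterate f x m)

  infix 4 _∈⟨_⟩

  _∈⟨_⟩ : X → X → Set _
  y ∈⟨ x ⟩ = ∃ λ k → GoodUpTo x k × iterate f x k ≡ y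

  Comparable : X → X → Set _
  Comparable x y = x ∈⟨ y ⟩ ⊎ y ∈⟨ x ⟩

  GoodUpTo-≤ : ∀ {x k l} → k ≤ l → GoodUpTo x l → GoodUpTo x k
  GoodUpTo-≤ k≤l good m m≤k = good m (≤-trans m≤k k≤l)

  GoodUpTo-drop : ∀ {x} j {k} → GoodUpTo x (j + k) → GoodUpTo (iterate f x j) k
  GoodUpTo-drop {x} j good m m≤k =
    subst Good (iterate-+ f x j m) (good (j + m) (+-monoʳ-≤ j m≤k))

  GoodUpTo-+ : ∀ {x} j {k} → GoodUpTo x j → GoodUpTo (iterate f x j) k → GoodUpTo x (j + k)
  GoodUpTo-+ {x} j {k} goodʲ goodᵏ m m≤j+k with m ≤? j
  ... | yes m≤j = goodʲ m m≤j
  ... | no  m≰j with m≤n⇒∃[o]m+o≡n (<⇒≤ (≰⇒> m≰j))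
  ...   | o , refl = subst Good (sym (iterate-+ f x j o)) (goodᵏ o (+-cancelˡ-≤ j o k m≤j+k))

  ∈⟨⟩-refl : ∀ {x} → Good x → x ∈⟨ x ⟩
  ∈⟨⟩-refl good = 0 , (λ { _ z≤n → good }) , refl

  ∈⟨⟩-trans : ∀ {x y z} → x ∈⟨ y ⟩ → y ∈⟨ z ⟩ → x ∈⟨ z ⟩
  ∈⟨⟩-trans {z = z} (j , goodʲ , refl) (k , goodᵏ , refl) =
    k + j , GoodUpTo-+ k goodᵏ goodʲ , iterate-+ f z k j

  iterate-∈⟨iterate⟩ : ∀ {x} j {d} → GoodUpTo x (j + d) → iterate f x (j + d) ∈⟨ iterate f x j ⟩
  iterate-∈⟨iterate⟩ {x} j {d} good = d , GoodUpTo-drop j good , sym (iterate-+ f x j d)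

  ∈⟨⟩-fork : ∀ {x y z} → x ∈⟨ y ⟩ → z ∈⟨ y ⟩ → Comparable x z
  ∈⟨⟩-fork (j , goodʲ , refl) (k , goodᵏ , refl) with ≤-total-+ j k
  ... | inj₁ (d , refl) = inj₂ (iterate-∈⟨iterate⟩ j goodᵏ)
  ... | inj₂ (d , refl) = inj₁ (iterate-∈⟨iterate⟩ k goodʲ)

  module _ (f-injective : Injective _≡_ _≡_ f) where

    ∈⟨⟩-cancel : ∀ {x z} j {d} → GoodUpTo z (j + d) → iterate f z (j + d) ≡ iterate f x j →
                 x ∈⟨ z ⟩
    ∈⟨⟩-cancel {x} {z} j {d} good eq =
      d , GoodUpTo-≤ (m≤n+m d j) good , iterate-injective f f-injective j (begin
        iterate f (iterate f z d) j ≡⟨ iterate-+ f z d j ⟨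
        iterate f z (d + j)         ≡⟨ cong (iterate f z) (+-comm d j) ⟩
        iterate f z (j + d)         ≡⟨ eq ⟩
        iterate f x j               ∎)
      where open ≡-Reasoning

    ∈⟨⟩-join : ∀ {x y z} → y ∈⟨ x ⟩ → y ∈⟨ z ⟩ → Comparable x z
    ∈⟨⟩-join (j , goodʲ , eqʲ) (k , goodᵏ , eqᵏ) with ≤-total-+ j k
    ... | inj₁ (d , refl) = inj₁ (∈⟨⟩-cancel j goodᵏ (trans eqᵏ (sym eqʲ)))
    ... | inj₂ (d , refl) = inj₂ (∈⟨⟩-cancel k goodʲ (trans eqʲ (sym eqᵏ)))

    Comparable-trans : ∀ {x y z} → Comparable x y → Comparable y z → Comparable x z
    Comparable-trans (inj₁ x∈y) (inj₁ y∈z) = inj₁ (∈⟨⟩-trans x∈y y∈z)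
    Comparable-trans (inj₂ y∈x) (inj₂ z∈y) = inj₂ (∈⟨⟩-trans z∈y y∈x)
    Comparable-trans (inj₁ x∈y) (inj₂ z∈y) = ∈⟨⟩-fork x∈y z∈y
    Comparable-trans (inj₂ y∈x) (inj₁ y∈z) = ∈⟨⟩-join y∈x y∈z

    Comparable-isEquivalence : (S : X → Set r) → (∀ {x} → S x → Good x) →
                               IsEquivalence {A = Σ X S} (λ (x , _) (y , _) → Comparable x y)
    Comparable-isEquivalence S S⇒Good = record
      { refl  = λ { {_ , sx} → inj₁ (∈⟨⟩-refl (S⇒Good sx)) }
      ; sym   = swap
      ; trans = Comparable-trans
      }

module _ (i : Idx) (p : ℕ) .{{_ : NonZero p}} where

  open Orbit (step i p) (λ x → toℕ x ≢ 0) public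

  u-suc≡iterate : ∀ g k → u i p g (suc k) ≡ iterate (step i p) g k
  u-suc≡iterate g zero    = refl
  u-suc≡iterate g (suc k) =
    trans (cong (step i p) (u-suc≡iterate g k)) (sym (iterate-suc (step i p) g k))

  InRogue⇔∈⟨⟩ : ∀ {x g} → InRogue i p x g ⇔ x ∈⟨ g ⟩
  InRogue⇔∈⟨⟩ {x} {g} = mk⇔ to from
    where
    to : InRogue i p x g → x ∈⟨ g ⟩
    to (suc k , _ , nonzero , eq) =
      k , (λ m m≤k → subst (λ v → toℕ v ≢ 0) (u-suc≡iterate g m) (nonzero (suc m) (s≤s z≤n) (s≤s m≤k)))
        , trans (sym (u-suc≡iterate g k)) eq
    from : x ∈⟨ g ⟩ → InRogue i p x g
    from (k , good , eq) =
      suc k , s≤s z≤n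
        , (λ { (suc m) _ (s≤s m≤k) → subst (λ v → toℕ v ≢ 0) (sym (u-suc≡iterate g m)) (good m m≤k) })
        , trans (u-suc≡iterate g k) eq

mainTheorem6 : (p : ℕ) .{{_ : NonZero p}} → Prime p → p ≢ 2 → (i : Idx) →
    IsEquivalence (R i p)
mainTheorem6 p pp p≢2 i = IsEquivalence-⇔ (InRogue⇔∈⟨⟩ i p ⊎-⇔ InRogue⇔∈⟨⟩ i p)
  (Comparable-isEquivalence i p (step-injective pp p≢2 i) (InA i p) proj₁)
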